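{- For every fixed $k\in\mathbb{N}$ there is $L>0$ such that for every sufficiently large $r$ there exists a $k$-graph $T$ with at most $Lr$ vertices and at most $Lr$ edges, together with a set $Z\subseteq V(T)$ of $r$ vertices, such that for every set $W\subseteq Z$ with $|W|<r/2$ and $|V(T)|-|W|$ divisible by $k$, the hypergraph $T-W$ has a perfect matching.
   Context: A $k$-graph has edges that are $k$-element subsets of its vertex set. $T-W$ denotes the hypergraph obtained by deleting the vertices of $W$ and all edges meeting $W$. A perfect matching is a set of pairwise disjoint edges covering all vertices. -}

module Defs where

open import Data.Nat using (ℕ)
open import Data.Fin using (Fin)
open import Data.Fin.Subset using (Subset; ∣_∣; _∈_; _∉_)
open import Data.List using (List; length)
open import Data.List.Relation.Unary.All using (All)
open import Data.List.Relation.Unary.Unique.Propositional using (Unique)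
open import Data.List.Relation.Unary.AllPairs using (AllPairs)
open import Data.List.Relation.Binary.Sublist.Propositional using ()
  renaming (_⊆_ to _⊑_)
open import Data.List.Membership.Propositional using () renaming (_∈_ to _∈ₗ_)
open import Relation.Binary.PropositionalEquality using (_≡_)
open import Data.Product using (Σ; ∃; _×_)

record KGraph (k n : ℕ) : Set where
  field
    edges    : List (Subset n)
    unique   : Unique edges
    uniform  : All (λ e → ∣ e ∣ ≡ k) edges
open KGraph public

Disjoint : {n : ℕ} → Subset n → Subset n → Set
Disjoint {n} e f = (v : Fin n) → v ∈ e → v ∉ f

-- An edge meets W iff it is not disjoint from W; edges of T - W are those disjoint from W.
PerfectMatchingMinus : {k n : ℕ} → KGraph k n → Subset n → Set
PerfectMatchingMinus {k} {n} T W =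
  Σ (List (Subset n)) λ M →
    (M ⊑ edges T) ×
    All (λ e → Disjoint e W) M ×
    AllPairs Disjoint M ×
    ((v : Fin n) → v ∉ W → ∃ λ e → (e ∈ₗ M) × (v ∈ e))

module Submission where

-- Construction: for k = c + 1 the k-graph T lives on the positions 0, …, n-1 of a
-- line.  Its edges are the "windows with at most one hole": a k-set starting at
-- some position i and contained in {i, …, i + k}.  There are at most k such edges
-- per starting position, hence at most n·k edges.  Z is the set of block starts
-- {0, k, 2k, …} of the line of length n = r·k.
--
-- Every W ⊆ Z is k-sparse (each element is followed by c positions outside W).
-- Deleting a sparse W, and assuming k divides the number of surviving vertices,
-- we cut the survivors greedily from left to right into runs of k consecutive
-- survivors; a run skips at most one vertex of W, so it is an edge of T - W.  The theorem then
-- takes L = k·k.  For k = 0 the hypotheses on W are contradictory and the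
-- edgeless graph works.

open import Defs
open import Data.Nat using (ℕ; _≤_; _<_; _*_; _∸_)
open import Data.Nat.Divisibility using (_∣_)
open import Relation.Binary.PropositionalEquality using (_≡_)
open import Data.Fin.Subset using (Subset; ∣_∣; _⊆_)
open import Data.List using (length)
open import Data.Product using (Σ; _×_)

open import Data.Nat using (zero; suc; _+_; z≤n; s≤s)
open import Data.Nat.Properties using (≤-refl; ≤-reflexive; ≤-trans; <-irrefl; <-≤-trans; <⇒≤; +-mono-≤;
  suc-injective; *-assoc; *-comm; *-identityˡ; m≤m*n; m≤m+n; m∸n≡0⇒m≤n)
open import Data.Nat.Divisibility using (divides; 0∣⇒≡0)
open import Relation.Binary.PropositionalEquality using (refl; sym; trans; cong; cong₂; subst)
open import Data.Bool using (Bool; not)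
open import Data.Fin using (zero; suc)
open import Data.Fin.Subset using (⊥; ⊤; ∁; _∈_; _∉_; inside; outside)
open import Data.Fin.Subset.Properties using (∉⊥; ∣⊥∣≡0; drop-∷-⊆; ∣⊤∣≡n; ∣∁p∣≡n∸∣p∣)
open import Data.Vec using ([]; _∷_; here; there; _++_)
open import Data.Vec.Properties using (∷-injectiveˡ; ∷-injectiveʳ)
open import Data.List using (List; []; _∷_; map) renaming (_++_ to _++ₗ_)
open import Data.List.Properties using (length-++; length-map)
open import Data.List.Relation.Unary.All using (All; []; _∷_)
import Data.List.Relation.Unary.All as All
import Data.List.Relation.Unary.All.Properties as AllProp
open import Data.List.Relation.Unary.AllPairs using (AllPairs; []; _∷_)
import Data.List.Relation.Unary.AllPairs as AllPairs
import Data.List.Relation.Unary.AllPairs.Properties as AllPairsProp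
open import Data.List.Relation.Unary.Unique.Propositional using (Unique)
import Data.List.Relation.Unary.Unique.Propositional.Properties as UniqueProp
open import Data.List.Relation.Binary.Disjoint.Propositional using ()
  renaming (Disjoint to DisjointLists)
open import Data.List.Relation.Binary.Sublist.Propositional using ([]; from∈)
  renaming (_⊆_ to _⊑_)
open import Data.List.Relation.Binary.Sublist.Propositional.Properties using (++⁺; ++⁺ˡ)
  renaming (map⁺ to ⊑-map⁺)
open import Data.List.Membership.Propositional using () renaming (_∈_ to _∈ₗ_)
open import Data.List.Membership.Propositional.Properties using (∈-map⁺; ∈-map⁻; ∈-++⁺ˡ; ∈-++⁺ʳ)
open import Data.List.Relation.Unary.Any using (here; there)
open import Data.Empty using (⊥-elim)
open import Data.Unit using (tt) renaming (⊤ to True)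
open import Data.Sum using (_⊎_; inj₁; inj₂)
open import Data.Product using (_,_; proj₂; ∃)
open import Relation.Nullary using (¬_)

zero∉outside : ∀ {m} {p : Subset m} → zero ∉ (outside ∷ p)
zero∉outside ()

Disjoint-∷ : ∀ {m} {a b} {e f : Subset m} →
             (zero ∈ (a ∷ e) → zero ∉ (b ∷ f)) → Disjoint e f → Disjoint (a ∷ e) (b ∷ f)
Disjoint-∷ head-ok tail-ok zero    v∈e v∈f = head-ok v∈e v∈f
Disjoint-∷ head-ok tail-ok (suc v) (there v∈e) (there v∈f) = tail-ok v v∈e v∈f

Disjoint-outside∷ˡ : ∀ {m} {b} {e f : Subset m} → Disjoint e f → Disjoint (outside ∷ e) (b ∷ f)
Disjoint-outside∷ˡ = Disjoint-∷ (λ z∈ → ⊥-elim (zero∉outside z∈))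

Disjoint-outside∷ʳ : ∀ {m} {a} {e f : Subset m} → Disjoint e f → Disjoint (a ∷ e) (outside ∷ f)
Disjoint-outside∷ʳ = Disjoint-∷ (λ _ → zero∉outside)

⊥-Disjoint : ∀ {m} (e : Subset m) → Disjoint ⊥ e
⊥-Disjoint e v v∈⊥ _ = ∉⊥ v∈⊥

FreePrefix : ∀ {m} → ℕ → Subset m → Set
FreePrefix zero    d       = True
FreePrefix (suc j) []      = True
FreePrefix (suc j) (b ∷ d) = b ≡ outside × FreePrefix j d

FreePrefix-mono : ∀ {m i j} (d : Subset m) → j ≤ i → FreePrefix i d → FreePrefix j d
FreePrefix-mono {j = zero}  d       _         _        = tt
FreePrefix-mono {j = suc j} []      _         _        = tt
FreePrefix-mono {j = suc j} (b ∷ d) (s≤s j≤i) (b≡ , f) = b≡ , FreePrefix-mono d j≤i f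

FreePrefix-⊆ : ∀ {m} i {w z : Subset m} → w ⊆ z → FreePrefix i z → FreePrefix i w
FreePrefix-⊆ zero    {w}                   _   _          = tt
FreePrefix-⊆ (suc i) {[]}                  _   _          = tt
FreePrefix-⊆ (suc i) {outside ∷ w} {_ ∷ z} w⊆z (_ , f)    = refl , FreePrefix-⊆ i (drop-∷-⊆ w⊆z) f
FreePrefix-⊆ (suc i) {inside ∷ w}  {_ ∷ z} w⊆z (refl , _) = ⊥-elim (zero∉outside (w⊆z here))

FreePrefix-⊥++ : ∀ i {m} (x : Subset m) → FreePrefix i (⊥ {i} ++ x)
FreePrefix-⊥++ zero    x = tt
FreePrefix-⊥++ (suc i) x = refl , FreePrefix-⊥++ i x

∣⊥++∣ : ∀ i {m} (x : Subset m) → ∣ ⊥ {i} ++ x ∣ ≡ ∣ x ∣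
∣⊥++∣ zero    x = refl
∣⊥++∣ (suc i) x = ∣⊥++∣ i x

map-∷-disjoint : ∀ {m} {b b′} (xs ys : List (Subset m)) → ¬ b ≡ b′ →
                 DisjointLists (map (b ∷_) xs) (map (b′ ∷_) ys)
map-∷-disjoint xs ys b≢b′ (p , q) with ∈-map⁻ _ p | ∈-map⁻ _ q
... | _ , _ , refl | _ , _ , eq = b≢b′ (∷-injectiveˡ eq)

map-∷-unique : ∀ {m} (b : Bool) {xs : List (Subset m)} → Unique xs → Unique (map (b ∷_) xs)
map-∷-unique b = UniqueProp.map⁺ ∷-injectiveʳ

length-branches : ∀ {m} (b b′ : Bool) (xs ys : List (Subset m)) →
                  length (map (b ∷_) xs ++ₗ map (b′ ∷_) ys) ≡ length xs + length ys
length-branches b b′ xs ys =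
  trans (length-++ (map (b ∷_) xs)) (cong₂ _+_ (length-map (b ∷_) xs) (length-map (b′ ∷_) ys))

module WindowGraph (c : ℕ) where

  k : ℕ
  k = suc c

  -- Completion j h m: the ways to choose the j missing vertices of an edge among
  -- the next m positions.  They are consecutive, except that if h (a hole is
  -- still allowed) one position may be skipped.
  Completion : ℕ → Bool → (m : ℕ) → List (Subset m)
  Completion zero    h       m       = ⊥ ∷ []
  Completion (suc j) h       zero    = []
  Completion (suc j) inside  (suc m) =
    map (outside ∷_) (Completion (suc j) outside m) ++ₗ map (inside ∷_) (Completion j inside m)
  Completion (suc j) outside (suc m) = map (inside ∷_) (Completion j outside m)

  -- The edges of the window graph on m positions: each edge starts at its least
  -- position and is completed by c further vertices, with at most one hole.
  Edges : (m : ℕ) → List (Subset m)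
  Edges zero    = []
  Edges (suc m) = map (inside ∷_) (Completion c inside m) ++ₗ map (outside ∷_) (Edges m)

  Completion-zero : ∀ h {m} {p : Subset m} → p ∈ₗ Completion 0 h m → p ≡ ⊥
  Completion-zero h (here p≡⊥) = p≡⊥

  Completion-size : ∀ j h m → All (λ e → ∣ e ∣ ≡ j) (Completion j h m)
  Completion-size zero    h       m       = ∣⊥∣≡0 m ∷ []
  Completion-size (suc j) h       zero    = []
  Completion-size (suc j) inside  (suc m) =
    AllProp.++⁺ (AllProp.map⁺ (Completion-size (suc j) outside m))
                (AllProp.map⁺ (All.map (cong suc) (Completion-size j inside m)))
  Completion-size (suc j) outside (suc m) =
    AllProp.map⁺ (All.map (cong suc) (Completion-size j outside m))

  Edges-size : ∀ m → All (λ e → ∣ e ∣ ≡ k) (Edges m)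
  Edges-size zero    = []
  Edges-size (suc m) =
    AllProp.++⁺ (AllProp.map⁺ (All.map (cong suc) (Completion-size c inside m)))
                (AllProp.map⁺ (Edges-size m))

  Completion-unique : ∀ j h m → Unique (Completion j h m)
  Completion-unique zero    h       m       = [] ∷ []
  Completion-unique (suc j) h       zero    = []
  Completion-unique (suc j) inside  (suc m) =
    UniqueProp.++⁺ (map-∷-unique outside (Completion-unique (suc j) outside m))
                   (map-∷-unique inside (Completion-unique j inside m))
                   (map-∷-disjoint _ _ (λ ()))
  Completion-unique (suc j) outside (suc m) = map-∷-unique inside (Completion-unique j outside m)

  Edges-unique : ∀ m → Unique (Edges m)
  Edges-unique zero    = []
  Edges-unique (suc m) =
    UniqueProp.++⁺ (map-∷-unique inside (Completion-unique c inside m))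
                   (map-∷-unique outside (Edges-unique m))
                   (map-∷-disjoint _ _ (λ ()))

  Completion-count-rigid : ∀ j m → length (Completion j outside m) ≤ 1
  Completion-count-rigid zero    m       = ≤-refl
  Completion-count-rigid (suc j) zero    = z≤n
  Completion-count-rigid (suc j) (suc m) =
    ≤-trans (≤-reflexive (length-map (inside ∷_) (Completion j outside m)))
            (Completion-count-rigid j m)

  Completion-count : ∀ j m → length (Completion j inside m) ≤ suc j
  Completion-count zero    m       = ≤-refl
  Completion-count (suc j) zero    = z≤n
  Completion-count (suc j) (suc m) =
    ≤-trans (≤-reflexive (length-branches outside inside (Completion (suc j) outside m)
                                                         (Completion j inside m)))
            (+-mono-≤ (Completion-count-rigid (suc j) m) (Completion-count j m))

  Edges-count : ∀ m → length (Edges m) ≤ m * k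
  Edges-count zero    = z≤n
  Edges-count (suc m) =
    ≤-trans (≤-reflexive (length-branches inside outside (Completion c inside m) (Edges m)))
            (+-mono-≤ (Completion-count c m) (Edges-count m))

  Window : (m : ℕ) → KGraph k m
  Window m = record { edges = Edges m ; unique = Edges-unique m ; uniform = Edges-size m }

  Sparse : ∀ {m} → Subset m → Set
  Sparse []            = True
  Sparse (outside ∷ d) = Sparse d
  Sparse (inside ∷ d)  = FreePrefix c d × Sparse d

  Sparse-tail : ∀ {m} b (d : Subset m) → Sparse (b ∷ d) → Sparse d
  Sparse-tail outside d s       = s
  Sparse-tail inside  d (_ , s) = s

  Sparse-⊆ : ∀ {m} {w z : Subset m} → w ⊆ z → Sparse z → Sparse w
  Sparse-⊆ {w = []}          {[]}          w⊆z s = tt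
  Sparse-⊆ {w = outside ∷ w} {b ∷ z}       w⊆z s = Sparse-⊆ (drop-∷-⊆ w⊆z) (Sparse-tail b z s)
  Sparse-⊆ {w = inside ∷ w}  {outside ∷ z} w⊆z s = ⊥-elim (zero∉outside (w⊆z here))
  Sparse-⊆ {w = inside ∷ w}  {inside ∷ z}  w⊆z (f , s) =
    FreePrefix-⊆ c (drop-∷-⊆ w⊆z) f , Sparse-⊆ (drop-∷-⊆ w⊆z) s

  Sparse-⊥++ : ∀ i {m} (x : Subset m) → Sparse x → Sparse (⊥ {i} ++ x)
  Sparse-⊥++ zero    x s = s
  Sparse-⊥++ (suc i) x s = Sparse-⊥++ i x s

  -- The state of the greedy scan on the last m positions, with deleted set d:
  -- an open piece (the tail of an edge that starts further left and still needs
  -- j vertices, with a hole allowed iff h) and a matching of Window m such that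
  -- both avoid d, are pairwise disjoint and together cover every vertex not in d.
  record Cover (m : ℕ) (d : Subset m) (j : ℕ) (h : Bool) : Set where
    field
      piece             : Subset m
      matching          : List (Subset m)
      piece-shape       : piece ∈ₗ Completion j h m
      matching-edges    : matching ⊑ Edges m
      piece-avoids      : Disjoint piece d
      matching-avoids   : All (λ e → Disjoint e d) matching
      matching-disjoint : AllPairs Disjoint matching
      piece-disjoint    : All (Disjoint piece) matching
      covers            : ∀ v → v ∉ d → v ∈ piece ⊎ ∃ λ e → e ∈ₗ matching × v ∈ e

  cover-empty : ∀ {h} → Cover 0 [] 0 h
  cover-empty = record
    { piece = [] ; matching = [] ; piece-shape = here refl ; matching-edges = []
    ; piece-avoids = λ () ; matching-avoids = [] ; matching-disjoint = []
    ; piece-disjoint = [] ; covers = λ () }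

  lift-edges : ∀ {m} {M : List (Subset m)} → M ⊑ Edges m → map (outside ∷_) M ⊑ Edges (suc m)
  lift-edges {m} M⊑E = ++⁺ˡ (map (inside ∷_) (Completion c inside m)) (⊑-map⁺ (outside ∷_) M⊑E)

  lift-avoids : ∀ {m b} {d : Subset m} {M : List (Subset m)} →
                All (λ e → Disjoint e d) M → All (λ e → Disjoint e (b ∷ d)) (map (outside ∷_) M)
  lift-avoids M-avoids = AllProp.map⁺ (All.map Disjoint-outside∷ˡ M-avoids)

  lift-disjoint : ∀ {m} {M : List (Subset m)} → AllPairs Disjoint M → AllPairs Disjoint (map (outside ∷_) M)
  lift-disjoint M-disjoint = AllPairsProp.map⁺ (AllPairs.map Disjoint-outside∷ˡ M-disjoint)

  lift-apart : ∀ {m b} {p : Subset m} {M : List (Subset m)} →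
               All (Disjoint p) M → All (Disjoint (b ∷ p)) (map (outside ∷_) M)
  lift-apart p-apart = AllProp.map⁺ (All.map Disjoint-outside∷ʳ p-apart)

  lift-member : ∀ {m} {M : List (Subset m)} {v e} → e ∈ₗ M → v ∈ e →
                ∃ λ e′ → e′ ∈ₗ map (outside ∷_) M × suc v ∈ e′
  lift-member {e = e} e∈M v∈e = outside ∷ e , ∈-map⁺ (outside ∷_) e∈M , there v∈e

  -- Scan step at a new leftmost position x: if x is deleted the piece skips it,
  -- otherwise the piece takes it (so the new piece has head 'not x').
  extend : ∀ {m d j h j′ h′} (x : Bool) (C : Cover m d j′ h′) →
           (not x ∷ Cover.piece C) ∈ₗ Completion j h (suc m) → Cover (suc m) (x ∷ d) j h
  extend {m} {d} x C shape = record
    { piece = not x ∷ piece ; matching = map (outside ∷_) matching ; piece-shape = shape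
    ; matching-edges = lift-edges matching-edges
    ; piece-avoids = Disjoint-∷ (head-apart x) piece-avoids
    ; matching-avoids = lift-avoids matching-avoids
    ; matching-disjoint = lift-disjoint matching-disjoint
    ; piece-disjoint = lift-apart piece-disjoint
    ; covers = covers′ }
    where
    open Cover C
    head-apart : ∀ x {q : Subset m} → zero ∈ (not x ∷ piece) → zero ∉ (x ∷ q)
    head-apart inside  ()
    head-apart outside _ ()
    head-covered : ∀ x {q : Subset m} → zero ∉ (x ∷ q) → zero ∈ (not x ∷ piece)
    head-covered inside  z∉ = ⊥-elim (z∉ here)
    head-covered outside _  = here
    covers′ : ∀ v → v ∉ (x ∷ d) →
              v ∈ (not x ∷ piece) ⊎ ∃ λ e → e ∈ₗ map (outside ∷_) matching × v ∈ e
    covers′ zero    v∉ = inj₁ (head-covered x v∉)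
    covers′ (suc v) v∉ with covers v (λ v∈d → v∉ (there v∈d))
    ... | inj₁ v∈piece       = inj₁ (there v∈piece)
    ... | inj₂ (e , e∈ , v∈e) = inj₂ (lift-member e∈ v∈e)

  -- Scan step at a free position when no edge is open: it starts a new edge,
  -- completed by a piece of the scan further right, and leaves an empty piece.
  close : ∀ {m d h} → Cover m d c inside → Cover (suc m) (outside ∷ d) 0 h
  close {m} {d} C = record
    { piece = ⊥ ; matching = (inside ∷ piece) ∷ map (outside ∷_) matching ; piece-shape = here refl
    ; matching-edges = ++⁺ (from∈ (∈-map⁺ (inside ∷_) piece-shape)) (⊑-map⁺ (outside ∷_) matching-edges)
    ; piece-avoids = ⊥-Disjoint _
    ; matching-avoids = Disjoint-outside∷ʳ piece-avoids ∷ lift-avoids matching-avoids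
    ; matching-disjoint = lift-apart piece-disjoint ∷ lift-disjoint matching-disjoint
    ; piece-disjoint = All.universal ⊥-Disjoint _
    ; covers = covers′ }
    where
    open Cover C
    covers′ : ∀ v → v ∉ (outside ∷ d) →
              v ∈ ⊥ ⊎ ∃ λ e → e ∈ₗ (inside ∷ piece) ∷ map (outside ∷_) matching × v ∈ e
    covers′ zero    _  = inj₂ (inside ∷ piece , here refl , here)
    covers′ (suc v) v∉ with covers v (λ v∈d → v∉ (there v∈d))
    ... | inj₁ v∈piece = inj₂ (inside ∷ piece , here refl , there v∈piece)
    ... | inj₂ (e , e∈ , v∈e) with lift-member e∈ v∈e
    ... | e′ , e′∈ , v∈e′ = inj₂ (e′ , there e′∈ , v∈e′)

  -- Invariant: the open piece needs j ≤ c more vertices, if no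
  -- hole is allowed the next j positions are free, and the number of free
  -- positions is j plus a multiple of k.  Sparseness guarantees that a piece
  -- never meets two deleted positions.
  greedy-cover : ∀ {m} (d : Subset m) j h q → j ≤ c → Sparse d → (h ≡ outside → FreePrefix j d) →
                 ∣ ∁ d ∣ ≡ j + q * k → Cover m d j h
  greedy-cover []            zero    h q _ _ _ _ = cover-empty
  greedy-cover []            (suc j) h q _ _ _ ()
  greedy-cover (inside ∷ d)  zero    h q _ (_ , sparse) _ count =
    extend inside C (here (cong (outside ∷_) (Completion-zero h (Cover.piece-shape C))))
    where
    C : Cover _ d 0 h
    C = greedy-cover d 0 h q z≤n sparse (λ _ → tt) count
  greedy-cover (inside ∷ d)  (suc j) outside q _ _ rigid _ with rigid refl
  ... | () , _
  greedy-cover (inside ∷ d)  (suc j) inside q j<c (free , sparse) _ count =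
    extend inside C (∈-++⁺ˡ (∈-map⁺ (outside ∷_) (Cover.piece-shape C)))
    where
    C : Cover _ d (suc j) outside
    C = greedy-cover d (suc j) outside q j<c sparse (λ _ → FreePrefix-mono d j<c free) count
  greedy-cover (outside ∷ d) zero    h zero    _ _ _ ()
  greedy-cover (outside ∷ d) zero    h (suc q) _ sparse _ count =
    close (greedy-cover d c inside q ≤-refl sparse (λ ()) (suc-injective count))
  greedy-cover (outside ∷ d) (suc j) inside q j<c sparse _ count =
    extend outside C (∈-++⁺ʳ (map (outside ∷_) (Completion (suc j) outside _))
                             (∈-map⁺ (inside ∷_) (Cover.piece-shape C)))
    where
    C : Cover _ d j inside
    C = greedy-cover d j inside q (<⇒≤ j<c) sparse (λ ()) (suc-injective count)
  greedy-cover (outside ∷ d) (suc j) outside q j<c sparse rigid count =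
    extend outside C (∈-map⁺ (inside ∷_) (Cover.piece-shape C))
    where
    C : Cover _ d j outside
    C = greedy-cover d j outside q (<⇒≤ j<c) sparse (λ h≡ → proj₂ (rigid h≡)) (suc-injective count)

  sparse-perfect-matching : ∀ {m} (W : Subset m) → Sparse W → k ∣ (m ∸ ∣ W ∣) →
                            PerfectMatchingMinus (Window m) W
  sparse-perfect-matching {m} W sparse (divides q free≡) =
    matching , matching-edges , matching-avoids , matching-disjoint , covered
    where
    C : Cover m W 0 inside
    C = greedy-cover W 0 inside q z≤n sparse (λ ()) (trans (∣∁p∣≡n∸∣p∣ W) free≡)
    open Cover C
    covered : ∀ v → v ∉ W → ∃ λ e → e ∈ₗ matching × v ∈ e
    covered v v∉W with covers v v∉W
    ... | inj₁ v∈piece = ⊥-elim (∉⊥ (subst (v ∈_) (Completion-zero inside piece-shape) v∈piece))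
    ... | inj₂ found   = found

  BlockStarts : (r : ℕ) → Subset (r * k)
  BlockStarts zero    = []
  BlockStarts (suc r) = inside ∷ (⊥ {c} ++ BlockStarts r)

  BlockStarts-sparse : ∀ r → Sparse (BlockStarts r)
  BlockStarts-sparse zero    = tt
  BlockStarts-sparse (suc r) = FreePrefix-⊥++ c (BlockStarts r) , Sparse-⊥++ c _ (BlockStarts-sparse r)

  BlockStarts-size : ∀ r → ∣ BlockStarts r ∣ ≡ r
  BlockStarts-size zero    = refl
  BlockStarts-size (suc r) = cong suc (trans (∣⊥++∣ c (BlockStarts r)) (BlockStarts-size r))

  budget : ∀ r → r * k * k ≡ k * k * r
  budget r = trans (*-assoc r k k) (*-comm r (k * k))

  vertex-bound : ∀ r → r * k ≤ k * k * r
  vertex-bound r = ≤-trans (m≤m*n (r * k) k) (≤-reflexive (budget r))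

  edge-bound : ∀ r → length (Edges (r * k)) ≤ k * k * r
  edge-bound r = ≤-trans (Edges-count (r * k)) (≤-reflexive (budget r))

-- For k = 0 no deleted set W satisfies the hypotheses: 0 ∣ r ∸ |W| forces r ≤ |W|.
no-admissible-deletion : ∀ r w → 2 * w < r → ¬ (0 ∣ (r ∸ w))
no-admissible-deletion r w 2w<r 0∣r-w =
  <-irrefl refl (<-≤-trans 2w<r (≤-trans (m∸n≡0⇒m≤n (0∣⇒≡0 0∣r-w)) (m≤m+n w _)))

edgeless : ∀ {k n} → KGraph k n
edgeless = record { edges = [] ; unique = [] ; uniform = [] }

lemma7p3 : (k : ℕ) → Σ ℕ λ L → (1 ≤ L) × (Σ ℕ λ r₀ → (r : ℕ) → r₀ ≤ r →
    Σ ℕ λ n → Σ (KGraph k n) λ T → Σ (Subset n) λ Z →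
    (n ≤ L * r) × (length (edges T) ≤ L * r) × (∣ Z ∣ ≡ r) ×
    ((W : Subset n) → W ⊆ Z → 2 * ∣ W ∣ < r → k ∣ (n ∸ ∣ W ∣) →
    PerfectMatchingMinus T W))
lemma7p3 zero    = 1 , s≤s z≤n , 0 , λ r _ →
  r , edgeless , ⊤ , ≤-reflexive (sym (*-identityˡ r)) , z≤n , ∣⊤∣≡n r ,
  λ W _ 2w<r 0∣r-w → ⊥-elim (no-admissible-deletion r ∣ W ∣ 2w<r 0∣r-w)
lemma7p3 (suc c) = k * k , s≤s z≤n , 0 , λ r _ →
  r * k , Window (r * k) , BlockStarts r ,
  vertex-bound r , edge-bound r , BlockStarts-size r ,
  λ W W⊆Z _ k∣n-w → sparse-perfect-matching W (Sparse-⊆ W⊆Z (BlockStarts-sparse r)) k∣n-w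
  where open WindowGraph c
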